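{- Let $k\ge 2$ and $X\subseteq V(G_k)$. If $\operatorname{mm}(X)<k$, then one of $X$ and $V(G_k)\setminus X$ is small.
   Context: $G_k$ is the $k\times k$-grid with vertex set $\{(i,j):1\le i,j\le k\}$ and edges $(i,j)(i',j')$ with $|i-i'|+|j-j'|=1$. $C_i=\{(i,j):1\le j\le k\}$ and $R_j=\{(i,j):1\le i\le k\}$. For $X\subseteq V(G_k)$, $\operatorname{mm}(X)$ is the size of a maximum matching in $G_k$ among the edges with one end in $X$ and the other in $V(G_k)\setminus X$. A set $X\subseteq V(G_k)$ is small if $\operatorname{mm}(X)<k$ and $R_i\not\subseteq X$ for all $i=1,\dots,k$. -}

module Defs where

open import Data.Nat using (ℕ; _+_; _<_; ∣_-_∣)
open import Data.Fin using (Fin; toℕ)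
open import Data.Bool using (Bool; true; false; not)
open import Data.Product using (_×_; _,_; ∃)
open import Data.List using (List; length; concatMap; _∷_; [])
open import Data.List.Relation.Unary.All using (All)
open import Data.List.Relation.Unary.Unique.Propositional using (Unique)
open import Relation.Binary.PropositionalEquality using (_≡_)
open import Function using (_∘_)

-- Vertices of the k×k grid G_k; coordinates are 0-based (Fin k) instead of 1..k.
-- A vertex (i , j) lies in column C_i and row R_j.
V : ℕ → Set
V k = Fin k × Fin k

Adj : ∀ {k} → V k → V k → Set
Adj (i , j) (i' , j') = ∣ toℕ i - toℕ i' ∣ + ∣ toℕ j - toℕ j' ∣ ≡ 1

VSet : ℕ → Set
VSet k = V k → Bool

complement : ∀ {k} → VSet k → VSet k
complement X = not ∘ X

CrossEdge : ∀ {k} → VSet k → V k × V k → Set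
CrossEdge X (u , v) = Adj u v × (X u ≡ true) × (X v ≡ false)

endpoints : ∀ {k} → List (V k × V k) → List (V k)
endpoints = concatMap (λ { (u , v) → u ∷ v ∷ [] })

IsCrossMatching : ∀ {k} → VSet k → List (V k × V k) → Set
IsCrossMatching X M = All (CrossEdge X) M × Unique (endpoints M)

-- mm(X) < n : every such matching (in particular a maximum one) has fewer than n edges.
mm<_ : ∀ {k} → VSet k → ℕ → Set
mm<_ {k} X n = (M : List (V k × V k)) → IsCrossMatching X M → length M < n

RowNotIn : ∀ {k} → VSet k → Fin k → Set
RowNotIn X j = ∃ λ i → X (i , j) ≡ false

Small : ∀ k → VSet k → Set
Small k X = (mm< X) k × (∀ j → RowNotIn X j)

-- Reversing the edges of a cross matching of X gives one of its complement, so mm(X) = mm(V ∖ X).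
-- If neither X nor V ∖ X is small, X contains a full row a and V ∖ X a full row b. Then in every
-- column some two vertically adjacent vertices are separated by X (between rows a and b), and these
-- k crossing edges, lying in distinct columns, form a matching of size k.
module Submission where

open import Defs
open import Data.Bool using (Bool; true; false; if_then_else_)
open import Data.Bool.Properties using (not-¬) renaming (_≟_ to _≟ᵇ_)
open import Data.Fin using (Fin; zero; suc; toℕ; inject₁)
open import Data.Fin.Properties using (all?; any?; ¬∀⟶∃¬)
open import Data.List using (List; []; _∷_; map; length; allFin)
open import Data.List.Properties using (length-map; length-tabulate)
import Data.List.Relation.Binary.Permutation.Setoid as Permutation
import Data.List.Relation.Binary.Permutation.Setoid.Properties as Permutationₚ
open import Data.List.Relation.Binary.Disjoint.Propositional using (Disjoint)
open import Data.List.Relation.Unary.All using (All; []; _∷_)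
import Data.List.Relation.Unary.All as All
import Data.List.Relation.Unary.All.Properties as All
import Data.List.Relation.Unary.AllPairs as AllPairs
open import Data.List.Relation.Unary.AllPairs using ([]; _∷_)
import Data.List.Relation.Unary.AllPairs.Properties as AllPairs
open import Data.List.Relation.Unary.Unique.Propositional using (Unique)
open import Data.List.Relation.Unary.Unique.Propositional.Properties using (concat⁺; allFin⁺)
open import Data.Nat using (ℕ; zero; suc; _≤_; _<_; ∣_-_∣)
open import Data.Nat.Properties using (<-irrefl; ∣-∣-comm; ∣n-n∣≡0)
open import Data.Product using (_×_; _,_; ∃; ∃₂; proj₁; proj₂; swap)
open import Data.Sum using (_⊎_; inj₁; inj₂)
open import Function using (_∘_)
open import Relation.Nullary using (¬_; Dec; yes; no; contradiction)
open import Relation.Binary.PropositionalEquality using (_≡_; _≢_; refl; sym; trans; subst; setoid)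

Adj-sym : ∀ {k} {u v : V k} → Adj u v → Adj v u
Adj-sym {u = i , j} {i' , j'} a rewrite ∣-∣-comm (toℕ i') (toℕ i) | ∣-∣-comm (toℕ j') (toℕ j) = a

module _ {k : ℕ} where
  open Permutation (setoid (V k)) using (_↭_; ↭-refl; ↭-sym; ↭-swap)
  open Permutationₚ (setoid (V k)) using (Unique-resp-↭)

  endpoints-map-swap : (M : List (V k × V k)) → endpoints (map swap M) ↭ endpoints M
  endpoints-map-swap []      = ↭-refl
  endpoints-map-swap (e ∷ M) = ↭-swap _ _ (endpoints-map-swap M)

  Unique-endpoints-map-swap : (M : List (V k × V k)) → Unique (endpoints M) → Unique (endpoints (map swap M))
  Unique-endpoints-map-swap M = Unique-resp-↭ (↭-sym (endpoints-map-swap M))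

CrossEdge-complement-swap : ∀ {k} (X : VSet k) {e : V k × V k} → CrossEdge (complement X) e → CrossEdge X (swap e)
CrossEdge-complement-swap X {u , v} (adj , _ , _) with X u | X v
... | false | true = Adj-sym {u = u} adj , refl , refl

mm<-complement : ∀ {k n} (X : VSet k) → (mm< X) n → (mm< (complement X)) n
mm<-complement {n = n} X mm<n M (crossing , unique) =
  subst (_< n) (length-map swap M)
    (mm<n (map swap M) (All.map⁺ (All.map (CrossEdge-complement-swap X) crossing) , Unique-endpoints-map-swap M unique))

adjacent-change : ∀ {n} (f : Fin (suc n) → Bool) {j} → f zero ≢ f j → ∃ λ p → f (inject₁ p) ≢ f (suc p)
adjacent-change f {zero} f₀≢fⱼ = contradiction refl f₀≢fⱼ
adjacent-change {zero} f {suc ()}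
adjacent-change {suc n} f {suc j} f₀≢fⱼ with f zero ≟ᵇ f (suc zero)
... | no f₀≢f₁ = zero , f₀≢f₁
... | yes f₀≡f₁ with adjacent-change (f ∘ suc) {j} (f₀≢fⱼ ∘ trans f₀≡f₁)
...   | p , change = suc p , change

adjacent-change-between : ∀ {n} (f : Fin (suc n) → Bool) {j j'} → f j ≢ f j' → ∃ λ p → f (inject₁ p) ≢ f (suc p)
adjacent-change-between f {j} {j'} fⱼ≢fⱼ' with f zero ≟ᵇ f j
... | no f₀≢fⱼ = adjacent-change f f₀≢fⱼ
... | yes f₀≡fⱼ = adjacent-change f (fⱼ≢fⱼ' ∘ trans (sym f₀≡fⱼ))

∣inject₁-suc∣≡1 : ∀ {n} (p : Fin n) → ∣ toℕ (inject₁ p) - toℕ (suc p) ∣ ≡ 1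
∣inject₁-suc∣≡1 zero    = refl
∣inject₁-suc∣≡1 (suc p) = ∣inject₁-suc∣≡1 p

Adj-column : ∀ {k} (i : Fin k) {j j' : Fin k} → ∣ toℕ j - toℕ j' ∣ ≡ 1 → Adj (i , j) (i , j')
Adj-column i d rewrite ∣n-n∣≡0 (toℕ i) = d

column-edge : ∀ {k} → Fin k → Fin k × Fin k → V k × V k
column-edge i (j , j') = (i , j) , (i , j')

orient : ∀ {A : Set} → (A → Bool) → A → A → A × A
orient f x y = if f x then (x , y) else (y , x)

CrossEdge-column-orient : ∀ {k} (X : VSet k) i {j j'} → ∣ toℕ j - toℕ j' ∣ ≡ 1 → X (i , j) ≢ X (i , j') →
                          CrossEdge X (column-edge i (orient (λ r → X (i , r)) j j'))
CrossEdge-column-orient X i {j} {j'} d Xᵢⱼ≢Xᵢⱼ' with X (i , j) in eq | X (i , j') in eq'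
... | true  | false = Adj-column i {j} {j'} d , eq , eq'
... | false | true  = Adj-column i {j'} {j} (trans (∣-∣-comm (toℕ j') (toℕ j)) d) , eq' , eq
... | true  | true  = contradiction refl Xᵢⱼ≢Xᵢⱼ'
... | false | false = contradiction refl Xᵢⱼ≢Xᵢⱼ'

Unique-endpoints-map : ∀ {k} {A : Set} (col : V k → A) (E : A → V k × V k) →
                       (∀ a → proj₁ (E a) ≢ proj₂ (E a)) →
                       (∀ a → col (proj₁ (E a)) ≡ a × col (proj₂ (E a)) ≡ a) →
                       ∀ {as} → Unique as → Unique (endpoints (map E as))
Unique-endpoints-map col E loopless inside {as} unique =
  concat⁺ (All.map⁺ (All.map⁺ (All.universal distinct-ends as)))
          (AllPairs.map⁺ (AllPairs.map⁺ (AllPairs.map disjoint unique)))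
  where
  distinct-ends : ∀ a → Unique (proj₁ (E a) ∷ proj₂ (E a) ∷ [])
  distinct-ends a = (loopless a ∷ []) ∷ [] ∷ []

  labelled : ∀ a → All (λ v → col v ≡ a) (proj₁ (E a) ∷ proj₂ (E a) ∷ [])
  labelled a = proj₁ (inside a) ∷ proj₂ (inside a) ∷ []

  disjoint : ∀ {a a'} → a ≢ a' → Disjoint (proj₁ (E a) ∷ proj₂ (E a) ∷ []) (proj₁ (E a') ∷ proj₂ (E a') ∷ [])
  disjoint a≢a' (v∈ , v∈') = a≢a' (trans (sym (All.lookup (labelled _) v∈)) (All.lookup (labelled _) v∈'))

CrossEdge⇒≢ : ∀ {k} (X : VSet k) {u v : V k} → CrossEdge X (u , v) → u ≢ v
CrossEdge⇒≢ X (_ , Xu≡true , Xv≡false) refl with trans (sym Xu≡true) Xv≡false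
... | ()

split-columns⇒cross-matching : ∀ {k} (X : VSet k) → (∀ i → ∃₂ λ j j' → X (i , j) ≢ X (i , j')) →
                               ∃ λ M → IsCrossMatching X M × length M ≡ k
split-columns⇒cross-matching {zero}  X split = [] , ([] , []) , refl
split-columns⇒cross-matching {suc n} X split =
  map E (allFin _) ,
  (All.map⁺ (All.universal crossing (allFin _)) ,
   Unique-endpoints-map proj₁ E (CrossEdge⇒≢ X ∘ crossing) (λ _ → refl , refl) (allFin⁺ _)) ,
  trans (length-map E (allFin _)) (length-tabulate (λ i → i))
  where
  change : ∀ i → ∃ λ p → X (i , inject₁ p) ≢ X (i , suc p)
  change i = adjacent-change-between (λ r → X (i , r)) (proj₂ (proj₂ (split i)))

  E : Fin (suc n) → V (suc n) × V (suc n)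
  E i = column-edge i (orient (λ r → X (i , r)) (inject₁ (proj₁ (change i))) (suc (proj₁ (change i))))

  crossing : ∀ i → CrossEdge X (E i)
  crossing i = CrossEdge-column-orient X i (∣inject₁-suc∣≡1 (proj₁ (change i))) (proj₂ (change i))

split-columns⇒¬mm< : ∀ {k} (X : VSet k) → (∀ i → ∃₂ λ j j' → X (i , j) ≢ X (i , j')) → ¬ (mm< X) k
split-columns⇒¬mm< X split mm<k with split-columns⇒cross-matching X split
... | M , matching , |M|≡k = <-irrefl |M|≡k (mm<k M matching)

rowNotIn? : ∀ {k} (X : VSet k) j → Dec (RowNotIn X j)
rowNotIn? X j = any? (λ i → X (i , j) ≟ᵇ false)

¬RowNotIn⇒row⊆ : ∀ {k} (X : VSet k) {j} → ¬ RowNotIn X j → ∀ i → X (i , j) ≡ true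
¬RowNotIn⇒row⊆ X {j} ¬notIn i with X (i , j) in eq
... | true  = refl
... | false = contradiction (i , eq) ¬notIn

¬∀RowNotIn⇒∃row⊆ : ∀ {k} (X : VSet k) → ¬ (∀ j → RowNotIn X j) → ∃ λ j → ∀ i → X (i , j) ≡ true
¬∀RowNotIn⇒∃row⊆ {k} X ¬rows⊄X with ¬∀⟶∃¬ k _ (rowNotIn? X) ¬rows⊄X
... | j , ¬row⊄X = j , ¬RowNotIn⇒row⊆ X ¬row⊄X

lemma4p3 : (k : ℕ) → 2 ≤ k → (X : VSet k) → (mm< X) k → Small k X ⊎ Small k (complement X)
lemma4p3 k _ X mm<k with all? (rowNotIn? X) | all? (rowNotIn? (complement X))
... | yes rows⊄X | _          = inj₁ (mm<k , rows⊄X)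
... | no _       | yes rows⊄X̅ = inj₂ (mm<-complement X mm<k , rows⊄X̅)
... | no ¬rows⊄X | no ¬rows⊄X̅
  with ¬∀RowNotIn⇒∃row⊆ X ¬rows⊄X | ¬∀RowNotIn⇒∃row⊆ (complement X) ¬rows⊄X̅
...   | a , row-a⊆X | b , row-b⊆X̅ = contradiction mm<k (split-columns⇒¬mm< X split)
  where
  split : ∀ i → ∃₂ λ j j' → X (i , j) ≢ X (i , j')
  split i = a , b , λ eq → not-¬ eq (trans (row-a⊆X i) (sym (row-b⊆X̅ i)))
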